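{- Let $X$ be a finite totally ordered alphabet and $U\subseteq X\times X$. Suppose $\mathrm{inv}'_U$ and $\mathrm{maj}'_U$ are equidistributed on every rearrangement class of words over $X$. Then $S(U)$ is an equivalence relation on $X_U$ (reflexive, symmetric and transitive on $X_U$).
   Context: $S(U)=\{(x,y):(x,y)\in U\text{ and }(y,x)\in U\}$ is the symmetric part of $U$, and $X_U$ is the set of $x\in X$ such that $(x,y)\in S(U)$ for some $y\in X$. Words over $X$: finite sequences $w=x_1\cdots x_m$; a rearrangement class is the set of all words with prescribed numbers of occurrences of each letter. $\mathrm{maj}'_U w=\sum_{i=1}^{m-1}i\,\chi((x_i,x_{i+1})\in U)$, $\mathrm{inv}'_U w=\sum_{1\le i<j\le m}\chi((x_i,x_j)\in U)$, $\chi$ the truth indicator. Equidistributed on a class: for each $k$ the numbers of words in the class with statistic value $k$ coincide. -}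

module Defs where

open import Data.Bool using (Bool; true; false; if_then_else_)
open import Data.Nat using (ℕ; zero; suc; _+_; _*_; _≡ᵇ_)
open import Data.Fin using (Fin; _≟_)
open import Data.List using (List; []; _∷_; map; concatMap; length; filterᵇ)
open import Data.Nat.ListAction using (sum)
open import Data.Bool.ListAction using (and)
open import Data.List using () renaming (allFin to allFinL)
open import Relation.Nullary.Decidable using (⌊_⌋)
open import Relation.Binary.PropositionalEquality using (_≡_)
open import Data.Product using (_×_; ∃)

-- The alphabet X is Fin n, totally ordered by the usual order on Fin n.
-- A relation U ⊆ X × X is given by its (decidable) characteristic function.
Relation : ℕ → Set
Relation n = Fin n → Fin n → Bool

_∈U[_]_ : {n : ℕ} → Fin n → Relation n → Fin n → Set
x ∈U[ U ] y = U x y ≡ true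

InS : {n : ℕ} → Relation n → Fin n → Fin n → Set
InS U x y = (x ∈U[ U ] y) × (y ∈U[ U ] x)

InXU : {n : ℕ} → Relation n → Fin n → Set
InXU {n} U x = ∃ λ (y : Fin n) → InS U x y

Word : ℕ → Set
Word n = List (Fin n)

χ : Bool → ℕ
χ true = 1
χ false = 0

majAux : {n : ℕ} → Relation n → ℕ → Word n → ℕ
majAux U i [] = 0
majAux U i (x ∷ []) = 0
majAux U i (x ∷ y ∷ w) = i * χ (U x y) + majAux U (suc i) (y ∷ w)

maj′ : {n : ℕ} → Relation n → Word n → ℕ
maj′ U w = majAux U 1 w

inv′ : {n : ℕ} → Relation n → Word n → ℕ
inv′ U [] = 0
inv′ U (x ∷ w) = sum (map (λ y → χ (U x y)) w) + inv′ U w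

occ : {n : ℕ} → Fin n → Word n → ℕ
occ x [] = 0
occ x (y ∷ w) = (if ⌊ x ≟ y ⌋ then 1 else 0) + occ x w

allWords : (n m : ℕ) → List (Word n)
allWords n zero = [] ∷ []
allWords n (suc m) = concatMap (λ w → map (λ x → x ∷ w) (allFinL n)) (allWords n m)

rearrangementClass : {n : ℕ} → (Fin n → ℕ) → List (Word n)
rearrangementClass {n} c =
  filterᵇ (λ w → and (map (λ x → occ x w ≡ᵇ c x) (allFinL n)))
          (allWords n (sum (map c (allFinL n))))

Equidistributed : {n : ℕ} → (Word n → ℕ) → (Word n → ℕ) → List (Word n) → Set
Equidistributed f g ws =
  ∀ (k : ℕ) → length (filterᵇ (λ w → f w ≡ᵇ k) ws) ≡ length (filterᵇ (λ w → g w ≡ᵇ k) ws)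

IsEquivalenceOnXU : {n : ℕ} → Relation n → Set
IsEquivalenceOnXU {n} U =
  (∀ (x : Fin n) → InXU U x → InS U x x)
  × (∀ (x y : Fin n) → InXU U x → InXU U y → InS U x y → InS U y x)
  × (∀ (x y z : Fin n) → InXU U x → InXU U y → InXU U z →
       InS U x y → InS U y z → InS U x z)

{-# OPTIONS --safe #-}
module Submission where

-- If y occurs once in a word and every other letter s satisfies (s , y) ∈ S(U), then the
-- position of y forms a U-pair with every other position, so inv′_U ≥ length − 1.
-- Now let s, t ≠ y be S(U)-related to y and suppose (s , t) ∉ U. The word y s t has
-- maj′_U = χ((y,s) ∈ U) + 2 χ((s,t) ∈ U) = 1, whereas every rearrangement of it has
-- inv′_U ≥ 2, contradicting equidistribution; hence (s , t) ∈ U. Taking s = t gives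
-- reflexivity of S(U) on X_U, and applying it to (x , z) and (z , x) gives transitivity.

open import Defs
open import Algebra.Properties.CommutativeSemigroup using (interchange)
open import Data.Bool using (Bool; true; false; if_then_else_; T; T?)
open import Data.Bool.ListAction using (and)
open import Data.Bool.Properties using (¬-not)
open import Data.Empty using (⊥-elim)
open import Data.Fin using (Fin; zero; suc; _≟_)
open import Data.List using (List; []; _∷_; map; length; tabulate; allFin)
open import Data.List.Membership.Propositional using (_∈_)
open import Data.List.Membership.Propositional.Properties
  using (∈-map⁺; ∈-concatMap⁺; ∈-allFin; ∈-filter⁺; ∈-filter⁻)
open import Data.List.Properties using (map-cong; map-tabulate; tabulate-cong)
open import Data.List.Relation.Unary.Any using (here; there)
import Data.List.Relation.Unary.Any as Any
import Data.List.Relation.Unary.All as All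
open import Data.List.Relation.Unary.All.Properties using (all⁺; all⁻)
open import Data.Nat using (ℕ; zero; suc; _+_; _≤_; _≡ᵇ_; s≤s; s≤s⁻¹)
open import Data.Nat.ListAction using (sum)
open import Data.Nat.Properties
  using (≡ᵇ⇒≡; ≡⇒≡ᵇ; suc-injective; ≤-trans; ≤-reflexive; m≤m+n; m≤n+m; +-monoˡ-≤;
         +-commutativeSemigroup; 1+n≰n; 1+n≢0)
open import Data.Product using (_×_; _,_; proj₁; proj₂; ∃-syntax)
open import Function using (_∘_)
open import Relation.Binary.PropositionalEquality
  using (_≡_; _≢_; refl; sym; trans; cong; subst; module ≡-Reasoning)
open import Relation.Nullary.Decidable using (⌊_⌋; yes; no; ⌊⌋-map′)

open ≡-Reasoning

variable
  A : Set
  n : ℕ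

inhabited-by-length : {x : A} {xs ys : List A} → length xs ≡ length ys → x ∈ xs → ∃[ y ] y ∈ ys
inhabited-by-length {ys = y ∷ _} _  _  = y , here refl
inhabited-by-length {ys = []}    () (here _)
inhabited-by-length {ys = []}    () (there _)

sum-map-χ-all-true : (p : A → Bool) (xs : List A) → (∀ {x} → x ∈ xs → p x ≡ true) →
  sum (map (χ ∘ p) xs) ≡ length xs
sum-map-χ-all-true p []       _   = refl
sum-map-χ-all-true p (x ∷ xs) all rewrite all (here refl) =
  cong suc (sum-map-χ-all-true p xs (all ∘ there))

1≤sum-map-χ : (p : A → Bool) {x : A} {xs : List A} → x ∈ xs → p x ≡ true → 1 ≤ sum (map (χ ∘ p) xs)
1≤sum-map-χ p (here refl) px = ≤-trans (≤-reflexive (cong χ (sym px))) (m≤m+n _ _)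
1≤sum-map-χ p (there x∈) px  = ≤-trans (1≤sum-map-χ p x∈ px) (m≤n+m _ _)

sum-tabulate-0 : sum (tabulate {n = n} (λ _ → 0)) ≡ 0
sum-tabulate-0 {zero}  = refl
sum-tabulate-0 {suc n} = sum-tabulate-0 {n}

sum-tabulate-+ : (f g : Fin n → ℕ) →
  sum (tabulate (λ a → f a + g a)) ≡ sum (tabulate f) + sum (tabulate g)
sum-tabulate-+ {zero}  f g = refl
sum-tabulate-+ {suc n} f g
  rewrite sum-tabulate-+ (f ∘ suc) (g ∘ suc) =
  interchange +-commutativeSemigroup (f zero) (g zero) _ _

sum-tabulate-indicator : (y : Fin n) → sum (tabulate (λ a → if ⌊ a ≟ y ⌋ then 1 else 0)) ≡ 1
sum-tabulate-indicator {suc n} zero    = cong suc (sum-tabulate-0 {n})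
-- ⌊ suc a ≟ suc y ⌋ does not reduce to ⌊ a ≟ y ⌋: _≟_ goes through map′.
sum-tabulate-indicator {suc n} (suc y) =
  trans (cong sum (tabulate-cong (λ a → cong (if_then 1 else 0) (⌊⌋-map′ _ _ (a ≟ y)))))
        (sum-tabulate-indicator y)

length≡sum-occ : (w : Word n) → length w ≡ sum (map (λ a → occ a w) (allFin n))
length≡sum-occ {n} w rewrite map-tabulate {n = n} (λ a → a) (λ a → occ a w) = go w
  where
  go : (w : Word n) → length w ≡ sum (tabulate (λ a → occ a w))
  go []      = sym (sum-tabulate-0 {n})
  go (y ∷ w) rewrite sum-tabulate-+ (λ a → if ⌊ a ≟ y ⌋ then 1 else 0) (λ a → occ a w)
                   | sum-tabulate-indicator y = cong suc (go w)

occ-∷-≡ : (a : Fin n) (w : Word n) → occ a (a ∷ w) ≡ suc (occ a w)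
occ-∷-≡ a w with a ≟ a
... | yes _   = refl
... | no a≢a = ⊥-elim (a≢a refl)

occ-∷-≢ : {a b : Fin n} (w : Word n) → a ≢ b → occ a (b ∷ w) ≡ occ a w
occ-∷-≢ {a = a} {b} w a≢b with a ≟ b
... | yes a≡b = ⊥-elim (a≢b a≡b)
... | no _    = refl

occ≢0⇒∈ : {a : Fin n} (w : Word n) → occ a w ≢ 0 → a ∈ w
occ≢0⇒∈         []      occ≢0 = ⊥-elim (occ≢0 refl)
occ≢0⇒∈ {a = a} (y ∷ w) occ≢0 with a ≟ y
... | yes a≡y = here a≡y
... | no  _   = there (occ≢0⇒∈ w occ≢0)

∈⇒occ≢0 : {a : Fin n} {w : Word n} → a ∈ w → occ a w ≢ 0
∈⇒occ≢0 {a = a} {y ∷ w} a∈ with a ≟ y | a∈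
... | yes _  | _         = λ ()
... | no  _  | there a∈w = ∈⇒occ≢0 a∈w
... | no a≢y | here a≡y  = ⊥-elim (a≢y a≡y)

occ≡0⇒∉ : {a s : Fin n} {w : Word n} → occ a w ≡ 0 → s ∈ w → s ≢ a
occ≡0⇒∉ occ≡0 s∈w refl = ∈⇒occ≢0 s∈w occ≡0

∈-allWords : (w : Word n) → w ∈ allWords n (length w)
∈-allWords []      = here refl
∈-allWords (x ∷ w) =
  ∈-concatMap⁺ _ (Any.map (λ { refl → ∈-map⁺ (_∷ w) (∈-allFin x) }) (∈-allWords w))

record Rearrangement (v w : Word n) : Set where
  constructor rearrangement
  field occ-≡ : ∀ a → occ a v ≡ occ a w
open Rearrangement

length-rearrangement : {v w : Word n} → Rearrangement v w → length v ≡ length w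
length-rearrangement {n} {v} {w} r = begin
  length v                              ≡⟨ length≡sum-occ v ⟩
  sum (map (λ a → occ a v) (allFin n))  ≡⟨ cong sum (map-cong (occ-≡ r) (allFin n)) ⟩
  sum (map (λ a → occ a w) (allFin n))  ≡⟨ length≡sum-occ w ⟨
  length w                              ∎

∈-rearrangement : {a : Fin n} {v w : Word n} → Rearrangement v w → a ∈ v → a ∈ w
∈-rearrangement {a = a} {w = w} r a∈v = occ≢0⇒∈ w (∈⇒occ≢0 a∈v ∘ trans (occ-≡ r a))

∈-rearrangementClass⁺ : {v w : Word n} → Rearrangement v w → v ∈ rearrangementClass (λ a → occ a w)
∈-rearrangementClass⁺ {n} {v} {w} r =
  ∈-filter⁺ (T? ∘ counts-match) v∈allWords
            (all⁻ _ {xs = allFin n} (All.tabulate λ {a} _ → ≡⇒≡ᵇ _ _ (occ-≡ r a)))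
  where
  counts-match : Word n → Bool
  counts-match u = and (map (λ a → occ a u ≡ᵇ occ a w) (allFin n))
  v∈allWords : v ∈ allWords n (sum (map (λ a → occ a w) (allFin n)))
  v∈allWords = subst (λ m → v ∈ allWords n m)
                     (trans (length-rearrangement r) (length≡sum-occ w)) (∈-allWords v)

∈-rearrangementClass⁻ : {c : Fin n → ℕ} {v : Word n} →
  v ∈ rearrangementClass c → ∀ a → occ a v ≡ c a
∈-rearrangementClass⁻ {n} {c} {v} v∈ a =
  ≡ᵇ⇒≡ _ _ (All.lookup (all⁺ _ (allFin n) counts-match) (∈-allFin a))
  where
  counts-match : T (and (map (λ a → occ a v ≡ᵇ c a) (allFin n)))
  counts-match = proj₂ (∈-filter⁻ (T? ∘ _) {xs = allWords n (sum (map c (allFin n)))} v∈)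

equidistributed-attains : {f g : Word n → ℕ} {ws : List (Word n)} {w : Word n} →
  Equidistributed f g ws → w ∈ ws → ∃[ v ] v ∈ ws × f v ≡ g w
equidistributed-attains {f = f} {g} {ws} {w} E w∈ws
  with inhabited-by-length (sym (E (g w)))
         (∈-filter⁺ (T? ∘ λ u → g u ≡ᵇ g w) w∈ws (≡⇒≡ᵇ (g w) _ refl))
... | v , v∈ with ∈-filter⁻ (T? ∘ λ u → f u ≡ᵇ g w) {xs = ws} v∈
...   | v∈ws , fv≡gw = v , v∈ws , ≡ᵇ⇒≡ _ _ fv≡gw

attained-by-rearrangement : {f g : Word n → ℕ} →
  (∀ c → Equidistributed f g (rearrangementClass c)) →
  (w : Word n) → ∃[ v ] Rearrangement v w × f v ≡ g w
attained-by-rearrangement {f = f} {g} E w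
  with equidistributed-attains {f = f} {g} (E (λ a → occ a w))
                               (∈-rearrangementClass⁺ {w = w} (rearrangement λ _ → refl))
... | v , v∈ , fv≡gw = v , rearrangement (∈-rearrangementClass⁻ v∈) , fv≡gw

length≤suc-inv′ : (U : Relation n) (y : Fin n) (w : Word n) → occ y w ≡ 1 →
  (∀ {s} → s ∈ w → s ≢ y → InS U s y) → length w ≤ suc (inv′ U w)
length≤suc-inv′ U y (a ∷ w) once related with y ≟ a
... | yes refl = s≤s (≤-trans (≤-reflexive (sym (sum-map-χ-all-true (U y) w yU))) (m≤m+n _ _))
  where
  yU : ∀ {s} → s ∈ w → U y s ≡ true
  yU s∈w = proj₂ (related (there s∈w) (occ≡0⇒∉ (suc-injective once) s∈w))
... | no y≢a = s≤s (≤-trans (length≤suc-inv′ U y w once (related ∘ there)) (+-monoˡ-≤ _ 1≤sum))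
  where
  1≤sum : 1 ≤ sum (map (χ ∘ U a) w)
  1≤sum = 1≤sum-map-χ (U a) (occ≢0⇒∈ w (1+n≢0 ∘ trans (sym once)))
                            (proj₁ (related (here refl) (y≢a ∘ sym)))

2≤inv′-of-rearrangement : (U : Relation n) {s t y : Fin n} → s ≢ y → t ≢ y →
  InS U s y → InS U t y → {v : Word n} → Rearrangement v (y ∷ s ∷ t ∷ []) → 2 ≤ inv′ U v
2≤inv′-of-rearrangement U {s} {t} {y} s≢y t≢y sSy tSy {v} v≈w =
  s≤s⁻¹ (subst (_≤ suc (inv′ U v)) (length-rearrangement v≈w)
               (length≤suc-inv′ U y v (trans (occ-≡ v≈w y) y-once) related))
  where
  w : Word _
  w = y ∷ s ∷ t ∷ []
  y-once : occ y w ≡ 1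
  y-once = trans (occ-∷-≡ y (s ∷ t ∷ []))
                 (cong suc (trans (occ-∷-≢ (t ∷ []) (s≢y ∘ sym)) (occ-∷-≢ [] (t≢y ∘ sym))))
  related : ∀ {r} → r ∈ v → r ≢ y → InS U r y
  related r∈v r≢y with ∈-rearrangement v≈w r∈v
  ... | here refl                 = ⊥-elim (r≢y refl)
  ... | there (here refl)         = sSy
  ... | there (there (here refl)) = tSy
  ... | there (there (there ()))

common-S-neighbour⇒∈U : (U : Relation n) →
  (∀ c → Equidistributed (inv′ U) (maj′ U) (rearrangementClass c)) →
  {s t y : Fin n} → s ≢ y → t ≢ y → InS U s y → InS U t y → s ∈U[ U ] t
common-S-neighbour⇒∈U U E {s} {t} {y} s≢y t≢y sSy tSy = ¬-not sUt≢false
  where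
  w : Word _
  w = y ∷ s ∷ t ∷ []
  maj′≡1 : U s t ≡ false → maj′ U w ≡ 1
  maj′≡1 sUt rewrite proj₂ sSy | sUt = refl
  sUt≢false : U s t ≢ false
  sUt≢false sUt =
    let v , v≈w , inv′≡maj′ = attained-by-rearrangement {f = inv′ U} {maj′ U} E w
    in 1+n≰n (subst (2 ≤_) (trans inv′≡maj′ (maj′≡1 sUt))
                           (2≤inv′-of-rearrangement U s≢y t≢y sSy tSy {v} v≈w))

lemma6p4 : (n : ℕ) (U : Relation n) →
    (∀ (c : Fin n → ℕ) → Equidistributed (inv′ U) (maj′ U) (rearrangementClass c)) →
    IsEquivalenceOnXU U
lemma6p4 n U E = reflexive , symmetric , transitive
  where
  reflexive : ∀ x → InXU U x → InS U x x
  reflexive x (y , xSy@(xUy , _)) with x ≟ y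
  ... | yes refl = xUy , xUy
  ... | no x≢y   = let xUx = common-S-neighbour⇒∈U U E x≢y x≢y xSy xSy in xUx , xUx

  symmetric : ∀ x y → InXU U x → InXU U y → InS U x y → InS U y x
  symmetric _ _ _ _ (xUy , yUx) = yUx , xUy

  transitive : ∀ x y z → InXU U x → InXU U y → InXU U z → InS U x y → InS U y z → InS U x z
  transitive x y z _ _ _ xSy ySz@(yUz , zUy) with x ≟ y | z ≟ y
  ... | yes refl | _        = ySz
  ... | _        | yes refl = xSy
  ... | no x≢y   | no z≢y   = common-S-neighbour⇒∈U U E x≢y z≢y xSy (zUy , yUz)
                            , common-S-neighbour⇒∈U U E z≢y x≢y (zUy , yUz) xSy
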